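{- Let $n \geq 1$, $\Pi \subseteq S_n$ and $m \geq 2n$. Then the word graph $G_m(\Pi)$ has directed diameter at least $n$.
   Context: Word graphs: for $\Pi \subseteq S_n$, $m > n$ and a set $B$ with $|B| = m$, the word graph $G_m = G_m(\Pi)$ is the directed graph whose vertices are the words $x_1 \dots x_n$ over $B$ with pairwise distinct letters, with arcs $x_1 x_2 \dots x_n \to x_2 \dots x_n y$ for every $y \in B\setminus\{x_1,\dots,x_n\}$ and $x_1 \dots x_n \to x_{\pi(1)} \dots x_{\pi(n)}$ for every $\pi \in \Pi$. -}

module Defs where

open import Data.Nat using (ℕ; zero; suc; _+_; _<_)
open import Data.Empty using (⊥)
open import Data.Fin using (Fin; toℕ)
open import Data.Fin.Permutation using (Permutation′; _⟨$⟩ʳ_)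
open import Data.Vec using (Vec; lookup)
open import Data.Vec.Membership.Propositional using (_∉_)
open import Data.Vec.Relation.Unary.Unique.Propositional using (Unique)
open import Data.Product using (Σ; ∃; _×_; _,_; proj₁)
open import Relation.Binary.PropositionalEquality using (_≡_)

PermSet : ℕ → Set₁
PermSet n = Permutation′ n → Set

-- Vertices of G_m(Π): words x₁…xₙ over B = Fin m with pairwise distinct letters.
Word : ℕ → ℕ → Set
Word m n = Σ (Vec (Fin m) n) Unique

word : ∀ {m n} → Word m n → Vec (Fin m) n
word = proj₁

-- Shift arc  x₁ x₂ … xₙ → x₂ … xₙ y  with y ∉ {x₁,…,xₙ}.
-- Position i of the target equals position i+1 of the source (if i+1 < n),
-- and the last position (i+1 = n) holds y.
ShiftArc : ∀ {m n} → Vec (Fin m) n → Vec (Fin m) n → Set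
ShiftArc {m} {n} x x′ =
  ∃ λ (y : Fin m) → (y ∉ x) ×
    ((i : Fin n) →
      ((j : Fin n) → toℕ j ≡ suc (toℕ i) → lookup x′ i ≡ lookup x j)
      × (suc (toℕ i) ≡ n → lookup x′ i ≡ y))

PermArc : ∀ {m n} → Permutation′ n → Vec (Fin m) n → Vec (Fin m) n → Set
PermArc π x x′ = ∀ i → lookup x′ i ≡ lookup x (π ⟨$⟩ʳ i)

data Arc {m n : ℕ} (Π : PermSet n) (u v : Word m n) : Set where
  shift : ShiftArc (word u) (word v) → Arc Π u v
  perm  : (π : Permutation′ n) → Π π → PermArc π (word u) (word v) → Arc Π u v

data Walk {m n : ℕ} (Π : PermSet n) : ℕ → Word m n → Word m n → Set where
  [] : ∀ {u} → Walk Π zero u u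
  _∷_ : ∀ {k u v w} → Arc Π u v → Walk Π k v w → Walk Π (suc k) u w

-- dist(u,v) ≥ n: no directed walk from u to v of length < n
-- (this includes the case that v is unreachable, dist = ∞).
DistAtLeast : ∀ {m n} → PermSet n → Word m n → Word m n → ℕ → Set
DistAtLeast Π u v d = ∀ k → k < d → Walk Π k u v → ⊥

DiameterAtLeast : (m n : ℕ) → PermSet n → ℕ → Set
DiameterAtLeast m n Π d = ∃ λ (u : Word m n) → ∃ λ (v : Word m n) → DistAtLeast Π u v d

module Submission where

-- Fix a set S of letters and count how many distinct letters of S
-- still occur in the current word.  A permutation arc only rearranges the
-- letters of a word, and a shift arc deletes exactly one letter (the first
-- one), so along any arc this count drops by at most one.  Take
--   u = 0 1 … (n-1)   and   v = n (n+1) … (2n-1),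
-- both of which are words since 2n ≤ m, and let S be the letters below n.
-- Then u contains n letters of S and v none, so every walk from u to v has
-- length at least n.

open import Defs
open import Data.Nat using (ℕ; zero; suc; _+_; _*_; _≤_; _<_)
open import Data.Nat.Properties
  using (+-suc; +-identityʳ; +-cancelˡ-≡; +-monoʳ-<; <-≤-trans; ≤-trans; m≤m+n; m≤n⇒∃[o]m+o≡n; <⇒≱)
open import Data.Fin as Fin using (Fin; toℕ; fromℕ<; inject₁; punchIn)
open import Data.Fin.Properties
  using (toℕ<n; toℕ-fromℕ<; toℕ-inject₁; toℕ-injective; fromℕ<-injective; suc-injective;
         punchIn-injective; punchInᵢ≢i; any?)
open import Data.Fin.Permutation using (Permutation′; _⟨$⟩ʳ_; _⟨$⟩ˡ_; inverseʳ)
open import Data.Vec using (Vec; lookup; tabulate)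
open import Data.Vec.Properties using (lookup∘tabulate)
open import Data.Vec.Relation.Unary.Unique.Propositional.Properties using (tabulate⁺)
open import Data.Product using (Σ; ∃; _×_; _,_; proj₁)
open import Data.Empty using (⊥-elim)
open import Function using (_∘_)
open import Function.Definitions using (Injective)
open import Relation.Nullary using (yes; no)
open import Relation.Binary.Definitions using (DecidableEquality)
open import Relation.Binary.PropositionalEquality
  using (_≡_; _≢_; sym; trans; cong; subst; module ≡-Reasoning)

Injection : {A B : Set} → (A → B) → Set
Injection = Injective _≡_ _≡_

_occursIn_ : ∀ {m n} → Fin m → Vec (Fin m) n → Set
a occursIn x = ∃ λ i → lookup x i ≡ a

avoiding : ∀ {r} {A : Set} → DecidableEquality A → (g : Fin (suc r) → A) → Injection g
         → (a : A) → Σ (Fin r → Fin (suc r)) λ h → Injection h × (∀ i → g (h i) ≢ a)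
avoiding _≟_ g g-inj a with any? (λ j → g j ≟ a)
... | yes (j , gj≡a) =
  punchIn j , punchIn-injective j _ _ , λ i e → punchInᵢ≢i j i (g-inj (trans e (sym gj≡a)))
... | no no-hit = Fin.suc , suc-injective , λ i e → no-hit (Fin.suc i , e)

record Retains {m n} (S : Fin m → Set) (r : ℕ) (x : Vec (Fin m) n) : Set where
  field
    letter   : Fin r → Fin m
    distinct : Injection letter
    chosen   : ∀ i → S (letter i)
    occurs   : ∀ i → letter i occursIn x
open Retains

retainSubfamily : ∀ {m n r r′} {S : Fin m → Set} {x x′ : Vec (Fin m) n}
                → (R : Retains S r x) (h : Fin r′ → Fin r) → Injection h
                → (∀ i → letter R (h i) occursIn x′) → Retains S r′ x′
retainSubfamily R h h-inj occ = record
  { letter   = letter R ∘ h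
  ; distinct = h-inj ∘ distinct R
  ; chosen   = chosen R ∘ h
  ; occurs   = occ
  }

permArc-keeps : ∀ {m n} (π : Permutation′ n) {x x′ : Vec (Fin m) n} → PermArc π x x′
              → ∀ {a} → a occursIn x → a occursIn x′
permArc-keeps π {x} {x′} arc {a} (p , xp≡a) = π ⟨$⟩ˡ p , (begin
  lookup x′ (π ⟨$⟩ˡ p)              ≡⟨ arc (π ⟨$⟩ˡ p) ⟩
  lookup x (π ⟨$⟩ʳ (π ⟨$⟩ˡ p))      ≡⟨ cong (lookup x) (inverseʳ π) ⟩
  lookup x p                        ≡⟨ xp≡a ⟩
  a                                 ∎)
  where open ≡-Reasoning

shiftArc-keeps : ∀ {m n} {x x′ : Vec (Fin m) (suc n)} → ShiftArc x x′
               → ∀ {a} → a occursIn x → a ≢ lookup x Fin.zero → a occursIn x′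
shiftArc-keeps _ (Fin.zero , x₀≡a) a≢x₀ = ⊥-elim (a≢x₀ (sym x₀≡a))
shiftArc-keeps (_ , _ , shifted) (Fin.suc p , xp≡a) _ =
  inject₁ p , trans (proj₁ (shifted (inject₁ p)) (Fin.suc p) (cong suc (sym (toℕ-inject₁ p)))) xp≡a

arc-retains : ∀ {m n r} {Π : PermSet n} {S : Fin m → Set} {u v : Word m n}
            → Arc Π u v → Retains S (suc r) (word u) → Retains S r (word v)
arc-retains {u = x , _} {v = x′ , _} (perm π _ arc) R =
  retainSubfamily R Fin.suc suc-injective (permArc-keeps π {x} {x′} arc ∘ occurs R ∘ Fin.suc)
arc-retains {n = zero} (shift _) R with occurs R Fin.zero
... | () , _
arc-retains {n = suc _} {u = x , _} {v = x′ , _} (shift arc) R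
  with avoiding Fin._≟_ (letter R) (distinct R) (lookup x Fin.zero)
... | h , h-inj , avoids =
  retainSubfamily R h h-inj (λ i → shiftArc-keeps {x = x} {x′} arc (occurs R (h i)) (avoids i))

walk-retains : ∀ {m n k r} {Π : PermSet n} {S : Fin m → Set} {u v : Word m n}
             → Walk Π k u v → Retains S (k + r) (word u) → Retains S r (word v)
walk-retains []      R = R
walk-retains (a ∷ w) R = walk-retains w (arc-retains a R)

block : ∀ {m n} (o : ℕ) → o + n ≤ m → Fin n → Fin m
block o o+n≤m i = fromℕ< (<-≤-trans (+-monoʳ-< o (toℕ<n i)) o+n≤m)

toℕ-block : ∀ {m n} (o : ℕ) (o+n≤m : o + n ≤ m) (i : Fin n) → toℕ (block o o+n≤m i) ≡ o + toℕ i
toℕ-block o o+n≤m i = toℕ-fromℕ< _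

block-injective : ∀ {m n} (o : ℕ) (o+n≤m : o + n ≤ m) → Injection (block {m} {n} o o+n≤m)
block-injective o o+n≤m = toℕ-injective ∘ +-cancelˡ-≡ o _ _ ∘ fromℕ<-injective _ _ _ _

blockWord : ∀ {m n} (o : ℕ) → o + n ≤ m → Word m n
blockWord o o+n≤m = tabulate (block o o+n≤m) , tabulate⁺ (block-injective o o+n≤m)

Below : ∀ {m} → ℕ → Fin m → Set
Below k a = toℕ a < k

block-retains : ∀ {m n} (o : ℕ) (o+n≤m : o + n ≤ m) → Retains (Below (o + n)) n (word (blockWord o o+n≤m))
block-retains {n = n} o o+n≤m = record
  { letter   = block o o+n≤m
  ; distinct = block-injective o o+n≤m
  ; chosen   = λ i → subst (_< o + n) (sym (toℕ-block o o+n≤m i)) (+-monoʳ-< o (toℕ<n i))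
  ; occurs   = λ i → i , lookup∘tabulate (block o o+n≤m) i
  }

block-above : ∀ {m n} (o : ℕ) (o+n≤m : o + n ≤ m) {a : Fin m}
            → a occursIn word (blockWord {n = n} o o+n≤m) → o ≤ toℕ a
block-above o o+n≤m {a} (i , e) = subst (o ≤_) toℕ-letter (m≤m+n o (toℕ i))
  where
  toℕ-letter : o + toℕ i ≡ toℕ a
  toℕ-letter = trans (sym (toℕ-block o o+n≤m i))
                     (cong toℕ (trans (sym (lookup∘tabulate (block o o+n≤m) i)) e))

mainTheorem7 : (n m : ℕ) → 1 ≤ n → (Π : PermSet n) → 2 * n ≤ m
    → DiameterAtLeast m n Π n
mainTheorem7 n m _ Π 2n≤m = blockWord 0 n≤m , blockWord n n+n≤m , far
  where
  n+n≤m : n + n ≤ m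
  n+n≤m = subst (λ t → n + t ≤ m) (+-identityʳ n) 2n≤m

  n≤m : 0 + n ≤ m
  n≤m = ≤-trans (m≤m+n n n) n+n≤m

  -- A walk of length k < n keeps a letter below n, which cannot occur in v.
  far : DistAtLeast Π (blockWord 0 n≤m) (blockWord n n+n≤m) n
  far k k<n walk with m≤n⇒∃[o]m+o≡n k<n
  ... | r , 1+k+r≡n = <⇒≱ (chosen R Fin.zero) (block-above n n+n≤m (occurs R Fin.zero))
    where
    start : Retains (Below n) (k + suc r) (word (blockWord 0 n≤m))
    start = subst (λ t → Retains (Below n) t (word (blockWord 0 n≤m)))
                  (sym (trans (+-suc k r) 1+k+r≡n)) (block-retains 0 n≤m)

    R : Retains (Below n) (suc r) (word (blockWord n n+n≤m))
    R = walk-retains walk start
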